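{- Let $R$ be an $R_{\mathbb B}$-extension over a finite domain $D$. Then there exists a saturated $R_{\mathbb B}$-extension $R'\in\langle\{R\}\rangle_{\nexists}$.
   Context: For a tuple $t$ of length $n$ and indices $i_1,\dots,i_m$, $\mathrm{pr}_{i_1,\dots,i_m}(t)=(t[i_1],\dots,t[i_m])$, $\mathrm{pr}_{i_1,\dots,i_m}(R)=\{\mathrm{pr}_{i_1,\dots,i_m}(t)\mid t\in R\}$. An $n$-ary relation $R$ over $D$ ($|D|\ge2$) with $|R|=3$ is an $R_{\mathbb B}$-extension if there are distinct $a,b\in D$ and indices $i_1,\dots,i_8\in\{1,\dots,n\}$ with $\mathrm{pr}_{i_1,\dots,i_8}(R)=\{(a,a,b,b,b,a,a,b),(a,b,a,b,a,b,a,b),(b,a,a,a,b,b,a,b)\}$. An $n$-ary $R_{\mathbb B}$-extension $R=\{t_1,t_2,t_3\}$ is saturated if for every $1\le i\le n$ and every function $\tau:\{1,2,3\}\to\{1,2,3\}$ there exists $1\le j\le n$ with $(t_{\tau(1)}[i],t_{\tau(2)}[i],t_{\tau(3)}[i])=(t_1[j],t_2[j],t_3[j])$. $\langle\{R\}\rangle_{\nexists}$ is the set of relations definable by quantifier-free primitive positive formulas over $\{R\}$, i.e. conjunctions of atoms $R(\mathbf{x})$ and equalities $x=y$ over the free variables, with no existential quantification. -}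

module Defs where

open import Data.Nat using (ℕ)
open import Data.Fin using (Fin; zero; suc)
open import Data.Vec using (Vec; []; _∷_; lookup; map)
open import Data.List using (List)
open import Data.List.Relation.Unary.All using (All)
open import Data.Product using (Σ; ∃; _×_; _,_)
open import Data.Sum using (_⊎_)
open import Relation.Nullary using (¬_)
open import Relation.Binary.PropositionalEquality using (_≡_; _≢_)
open import Function.Bundles using (_⇔_)
open import Level using (0ℓ)

Rel : Set → ℕ → Set₁
Rel D n = Vec D n → Set

pr : {D : Set} {n m : ℕ} → Vec (Fin n) m → Vec D n → Vec D m
pr is t = map (lookup t) is

Enumerates : {D : Set} {n : ℕ} → Rel D n → Vec D n → Vec D n → Vec D n → Set
Enumerates R t₁ t₂ t₃ =
  (t₁ ≢ t₂) × (t₁ ≢ t₃) × (t₂ ≢ t₃) ×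
  (∀ x → R x ⇔ (x ≡ t₁ ⊎ x ≡ t₂ ⊎ x ≡ t₃))

rb₁ rb₂ rb₃ : {D : Set} → D → D → Vec D 8
rb₁ a b = a ∷ a ∷ b ∷ b ∷ b ∷ a ∷ a ∷ b ∷ []
rb₂ a b = a ∷ b ∷ a ∷ b ∷ a ∷ b ∷ a ∷ b ∷ []
rb₃ a b = b ∷ a ∷ a ∷ a ∷ b ∷ b ∷ a ∷ b ∷ []

IsRBExt : {D : Set} {n : ℕ} → Rel D n → Set
IsRBExt {D} {n} R =
  (Σ (Vec D n) λ t₁ → Σ (Vec D n) λ t₂ → Σ (Vec D n) λ t₃ → Enumerates R t₁ t₂ t₃) ×
  (Σ D λ a → Σ D λ b → (a ≢ b) × Σ (Vec (Fin n) 8) λ is →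
     ∀ (u : Vec D 8) →
       (Σ (Vec D n) λ t → R t × pr is t ≡ u) ⇔ (u ≡ rb₁ a b ⊎ u ≡ rb₂ a b ⊎ u ≡ rb₃ a b))

column : {D : Set} {n : ℕ} → Vec (Vec D n) 3 → (Fin 3 → Fin 3) → Fin n → Vec D 3
column ts τ i =
  lookup (lookup ts (τ zero)) i ∷ lookup (lookup ts (τ (suc zero))) i ∷
  lookup (lookup ts (τ (suc (suc zero)))) i ∷ []

idτ : Fin 3 → Fin 3
idτ x = x

IsSaturatedRBExt : {D : Set} {n : ℕ} → Rel D n → Set
IsSaturatedRBExt {D} {n} R =
  IsRBExt R ×
  (Σ (Vec D n) λ t₁ → Σ (Vec D n) λ t₂ → Σ (Vec D n) λ t₃ →
     Enumerates R t₁ t₂ t₃ ×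
     (∀ (i : Fin n) (τ : Fin 3 → Fin 3) → Σ (Fin n) λ j →
        column (t₁ ∷ t₂ ∷ t₃ ∷ []) τ i ≡ column (t₁ ∷ t₂ ∷ t₃ ∷ []) idτ j))

-- Quantifier-free primitive positive formulas over {R} (R n-ary) in free
-- variables x_0..x_{m-1}: conjunctions (lists) of atoms.
data Atom (n m : ℕ) : Set where
  rel : Vec (Fin m) n → Atom n m
  eq  : Fin m → Fin m → Atom n m

⟦_⟧ₐ : {D : Set} {n m : ℕ} → Atom n m → Rel D n → Vec D m → Set
⟦ rel js ⟧ₐ R s = R (map (lookup s) js)
⟦ eq p q ⟧ₐ R s = lookup s p ≡ lookup s q

-- R' ∈ ⟨{R}⟩_∄ : R' is exactly the set of satisfying assignments of some
-- quantifier-free pp-formula over {R}.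
QfppDefinable : {D : Set} {n m : ℕ} → Rel D n → Rel D m → Set
QfppDefinable {D} {n} {m} R R' =
  Σ (List (Atom n m)) λ φ → ∀ (s : Vec D m) → R' s ⇔ All (λ α → ⟦ α ⟧ₐ R s) φ

module Submission where

-- R_𝔹 is column closed, as its eight columns are all of {a,b}³.
-- (3) `RBForm R` presents R by rows u 0, u 1, u 2 projecting onto the rows of
-- R_𝔹; `presentation` and `isRBExt` convert between this and `IsRBExt`, and
-- `saturated` shows that column closed rows give a saturated extension.
-- (4) The spread of u has a block of n coordinates for each of the 27
-- self-maps σ of Fin 3, block σ of its c-th tuple being u (σ c).  It is
-- column closed and again presents an R_𝔹-extension.
-- (5) The spread is qfpp definable from R: every block lies in R, and
-- equalities tie block σ to the identity block, using that R_𝔹 is column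
-- closed (`Definability`).

open import Defs
open import Data.Nat using (ℕ; _*_)
open import Data.Nat.Properties using (n<1+n)
open import Data.Fin using (Fin; zero; suc; _<_; combine; remQuot; funToFin; finToFun)
open import Data.Fin.Properties using (remQuot-combine; combine-remQuot; finToFun-funToFin; <-irrefl; pigeonhole)
open import Data.Bool using (Bool; true; false; if_then_else_)
open import Data.Vec using (Vec; []; _∷_; lookup; map; tabulate)
open import Data.Vec.Properties using (lookup-map; lookup∘tabulate; tabulate∘lookup; tabulate-cong; tabulate-∘; map-∘; map-cong)
open import Data.List using (List; _++_)
import Data.List as List
open import Data.List.Relation.Unary.All using (All)
open import Data.List.Relation.Unary.All.Properties using (tabulate⁺; tabulate⁻; ++⁺; ++⁻)
open import Data.Product using (Σ; ∃; ∃₂; _×_; _,_; proj₁; proj₂; uncurry)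
open import Data.Sum using (_⊎_; inj₁; inj₂)
open import Data.Empty using (⊥-elim)
open import Relation.Binary.PropositionalEquality
open import Function using (_∘_; id)
open import Function.Definitions using (Injective)
open import Function.Bundles using (_⇔_; mk⇔; Equivalence)
import Function.Properties.Equivalence as ⇔

private
  variable
    A D E : Set
    n r s : ℕ

vext : {x y : Vec A n} → (∀ i → lookup x i ≡ lookup y i) → x ≡ y
vext {x = x} {y} h = trans (sym (tabulate∘lookup x)) (trans (tabulate-cong h) (tabulate∘lookup y))

combine-ind : {P : Fin (r * s) → Set} → (∀ σ i → P (combine σ i)) → ∀ p → P p
combine-ind {r} {s} {P} h p =
  subst P (combine-remQuot {r} s p) (h (proj₁ (remQuot {r} s p)) (proj₂ (remQuot {r} s p)))

_∈₃_ : A → (Fin 3 → A) → Set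
x ∈₃ f = x ≡ f zero ⊎ x ≡ f (suc zero) ⊎ x ≡ f (suc (suc zero))

∈₃⇔ : {x : A} {f : Fin 3 → A} → x ∈₃ f ⇔ (∃ λ c → x ≡ f c)
∈₃⇔ {x = x} {f} = mk⇔ to from
  where
  to : x ∈₃ f → ∃ λ c → x ≡ f c
  to (inj₁ e)        = zero , e
  to (inj₂ (inj₁ e)) = suc zero , e
  to (inj₂ (inj₂ e)) = suc (suc zero) , e
  from : (∃ λ c → x ≡ f c) → x ∈₃ f
  from (zero , e)           = inj₁ e
  from (suc zero , e)       = inj₂ (inj₁ e)
  from (suc (suc zero) , e) = inj₂ (inj₂ e)

-- Counting: if R ⊆ {t 0, t 1, t 2} contains three distinct elements
-- f 0, f 1, f 2, then these are all of R (pigeonhole on x, f 0, f 1, f 2).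
exhausts : {R : A → Set} {t f : Fin 3 → A} →
  (∀ {x} → R x → x ∈₃ t) → (∀ c → R (f c)) → Injective _≡_ _≡_ f →
  ∀ {x} → R x → ∃ λ c → x ≡ f c
exhausts {A = A} {R} {t} {f} within inR inj {x} Rx = collision (pigeonhole (n<1+n 3) slot)
  where
  candidate : Fin 4 → A
  candidate zero    = x
  candidate (suc c) = f c
  candidate∈R : ∀ i → R (candidate i)
  candidate∈R zero    = Rx
  candidate∈R (suc c) = inR c
  located : ∀ i → ∃ λ d → candidate i ≡ t d
  located i = Equivalence.to ∈₃⇔ (within (candidate∈R i))
  slot : Fin 4 → Fin 3
  slot i = proj₁ (located i)
  same : ∀ i j → slot i ≡ slot j → candidate i ≡ candidate j
  same i j e = trans (proj₂ (located i)) (trans (cong t e) (sym (proj₂ (located j))))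
  collision : (∃₂ λ i j → i < j × slot i ≡ slot j) → ∃ λ c → x ≡ f c
  collision (_ , zero , () , _)
  collision (zero , suc c , _ , e)      = c , same zero (suc c) e
  collision (suc c , suc d , c<d , e) = ⊥-elim (<-irrefl (cong suc (inj (same (suc c) (suc d) e))) c<d)

table : (Fin r → Fin s → A) → List A
table {s = s} f = List.tabulate (λ q → uncurry f (remQuot s q))

All-table : {P : A → Set} {f : Fin r → Fin s → A} → All P (table f) ⇔ (∀ i j → P (f i j))
All-table {r = r} {s} {P = P} {f} = mk⇔
  (λ all i j → subst (P ∘ uncurry f) (remQuot-combine i j) (tabulate⁻ all (combine i j)))
  (λ h → tabulate⁺ (λ q → h (proj₁ (remQuot {r} s q)) (proj₂ (remQuot {r} s q))))

-- Three rows are column closed when re-indexing them along any τ produces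
-- only columns already present; for a three-element relation this is
-- saturation.
ColumnClosed : (Fin 3 → Vec D n) → Set
ColumnClosed {n = n} f =
  ∀ (i : Fin n) (τ : Fin 3 → Fin 3) → ∃ λ j → ∀ s → lookup (f (τ s)) i ≡ lookup (f s) j

map-closed : (g : D → E) {f : Fin 3 → Vec D n} → ColumnClosed f → ColumnClosed (map g ∘ f)
map-closed g {f} closed i τ with closed i τ
... | j , moved = j , λ s → begin
    lookup (map g (f (τ s))) i  ≡⟨ lookup-map i g (f (τ s)) ⟩
    g (lookup (f (τ s)) i)      ≡⟨ cong g (moved s) ⟩
    g (lookup (f s) j)          ≡⟨ lookup-map j g (f s) ⟨
    lookup (map g (f s)) j      ∎
  where open ≡-Reasoning

closed-column : {f : Fin 3 → Vec D n} → ColumnClosed f →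
  ∀ i τ → ∃ λ j → column (tabulate f) τ i ≡ column (tabulate f) idτ j
closed-column {f = f} closed i τ with closed i τ
... | j , moved =
  j , cong₂ _∷_ (entry zero) (cong₂ _∷_ (entry (suc zero)) (cong₂ _∷_ (entry (suc (suc zero))) refl))
  where
  entry : ∀ s → lookup (lookup (tabulate f) (τ s)) i ≡ lookup (f s) j
  entry s = trans (cong (λ v → lookup v i) (lookup∘tabulate f (τ s))) (moved s)

rowB : Fin 3 → Vec Bool 8
rowB zero             = rb₁ false true
rowB (suc zero)       = rb₂ false true
rowB (suc (suc zero)) = rb₃ false true

columnB : Fin 8 → Vec Bool 3
columnB j = tabulate (λ c → lookup (rowB c) j)

columnIndex : Vec Bool 3 → Fin 8
columnIndex (false ∷ false ∷ true ∷ [])  = zero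
columnIndex (false ∷ true ∷ false ∷ [])  = suc zero
columnIndex (true ∷ false ∷ false ∷ [])  = suc (suc zero)
columnIndex (true ∷ true ∷ false ∷ [])   = suc (suc (suc zero))
columnIndex (true ∷ false ∷ true ∷ [])   = suc (suc (suc (suc zero)))
columnIndex (false ∷ true ∷ true ∷ [])   = suc (suc (suc (suc (suc zero))))
columnIndex (false ∷ false ∷ false ∷ []) = suc (suc (suc (suc (suc (suc zero)))))
columnIndex (true ∷ true ∷ true ∷ [])    = suc (suc (suc (suc (suc (suc (suc zero))))))

columnB-index : ∀ w → columnB (columnIndex w) ≡ w
columnB-index (false ∷ false ∷ false ∷ []) = refl
columnB-index (false ∷ false ∷ true ∷ [])  = refl
columnB-index (false ∷ true ∷ false ∷ [])  = refl
columnB-index (false ∷ true ∷ true ∷ [])   = refl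
columnB-index (true ∷ false ∷ false ∷ [])  = refl
columnB-index (true ∷ false ∷ true ∷ [])   = refl
columnB-index (true ∷ true ∷ false ∷ [])   = refl
columnB-index (true ∷ true ∷ true ∷ [])    = refl

-- Since every Boolean column occurs, the Boolean R_𝔹 is column closed.
rowB-closed : ColumnClosed rowB
rowB-closed i τ = columnIndex w , λ s → begin
    lookup (rowB (τ s)) i                    ≡⟨ lookup∘tabulate (λ s → lookup (rowB (τ s)) i) s ⟨
    lookup w s                               ≡⟨ cong (λ v → lookup v s) (columnB-index w) ⟨
    lookup (columnB (columnIndex w)) s       ≡⟨ lookup∘tabulate (λ c → lookup (rowB c) (columnIndex w)) s ⟩
    lookup (rowB s) (columnIndex w)          ∎
  where
  open ≡-Reasoning
  w : Vec Bool 3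
  w = tabulate (λ s → lookup (rowB (τ s)) i)

-- The rows of R_𝔹 over {a, b}: the image of rowB under false ↦ a, true ↦ b.
-- (So rb a b zero is rb₁ a b, and so on, by computation.)
rb : D → D → Fin 3 → Vec D 8
rb a b c = map (λ x → if x then b else a) (rowB c)

rb-closed : {a b : D} → ColumnClosed (rb a b)
rb-closed {a = a} {b} = map-closed (λ x → if x then b else a) {rowB} rowB-closed

rb-injective : {a b : D} → a ≢ b → Injective _≡_ _≡_ (rb a b)
rb-injective {a = a} {b} a≢b {c} {c'} = distinct c c'
  where
  at : ∀ k {u v : Vec D 8} → u ≡ v → lookup u k ≡ lookup v k
  at k = cong (λ v → lookup v k)
  distinct : ∀ c c' → rb a b c ≡ rb a b c' → c ≡ c'
  distinct zero             zero             _ = refl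
  distinct (suc zero)       (suc zero)       _ = refl
  distinct (suc (suc zero)) (suc (suc zero)) _ = refl
  distinct zero             (suc zero)       e = ⊥-elim (a≢b (at (suc zero) e))
  distinct zero             (suc (suc zero)) e = ⊥-elim (a≢b (at zero e))
  distinct (suc zero)       zero             e = ⊥-elim (a≢b (sym (at (suc zero) e)))
  distinct (suc zero)       (suc (suc zero)) e = ⊥-elim (a≢b (at zero e))
  distinct (suc (suc zero)) zero             e = ⊥-elim (a≢b (sym (at zero e)))
  distinct (suc (suc zero)) (suc zero)       e = ⊥-elim (a≢b (sym (at zero e)))

projection-injective : {a b : D} {idx : Vec (Fin n) 8} {row : Fin 3 → Vec D n} →
  a ≢ b → (∀ c → pr idx (row c) ≡ rb a b c) → Injective _≡_ _≡_ row
projection-injective {idx = idx} a≢b projects {c} {c'} e =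
  rb-injective a≢b (trans (sym (projects c)) (trans (cong (pr idx) e) (projects c')))

record RBForm (R : Rel D n) : Set where
  field
    a b      : D
    a≢b      : a ≢ b
    idx      : Vec (Fin n) 8
    row      : Fin 3 → Vec D n
    members  : ∀ x → R x ⇔ (∃ λ c → x ≡ row c)
    projects : ∀ c → pr idx (row c) ≡ rb a b c

  row-injective : Injective _≡_ _≡_ row
  row-injective = projection-injective a≢b projects

  row-at : ∀ c j → lookup (row c) (lookup idx j) ≡ lookup (rb a b c) j
  row-at c j = trans (sym (lookup-map j (lookup (row c)) idx)) (cong (λ v → lookup v j) (projects c))

enumerates : {R : Rel D n} {f : Fin 3 → Vec D n} → Injective _≡_ _≡_ f →
  (∀ x → R x ⇔ (∃ λ c → x ≡ f c)) → Enumerates R (f zero) (f (suc zero)) (f (suc (suc zero)))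
enumerates inj mem =
  (λ e → case₀₁ (inj e)) , (λ e → case₀₂ (inj e)) , (λ e → case₁₂ (inj e)) ,
  (λ x → ⇔.trans (mem x) (⇔.sym ∈₃⇔))
  where
  case₀₁ : zero ≢ suc {2} zero
  case₀₁ ()
  case₀₂ : zero ≢ suc {2} (suc zero)
  case₀₂ ()
  case₁₂ : suc {2} zero ≢ suc (suc zero)
  case₁₂ ()

-- Every R_𝔹-extension has a presentation: the tuples over the three rows
-- of R_𝔹 are distinct, so by counting they are all of R.
presentation : {R : Rel D n} → IsRBExt R → RBForm R
presentation {D = D} {n} {R} ((t₁ , t₂ , t₃ , _ , _ , _ , listed) , (a , b , a≢b , idx , projections)) = record
  { a = a ; b = b ; a≢b = a≢b ; idx = idx ; row = row ; projects = projects
  ; members = λ x → mk⇔ (exhausts {t = lookup (t₁ ∷ t₂ ∷ t₃ ∷ [])} within row∈R (projection-injective a≢b projects))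
                        (λ { (c , refl) → row∈R c })
  }
  where
  over : ∀ c → Σ (Vec D n) λ t → R t × pr idx t ≡ rb a b c
  over c = Equivalence.from (projections (rb a b c)) (Equivalence.from (∈₃⇔ {f = rb a b}) (c , refl))
  row : Fin 3 → Vec D n
  row c = proj₁ (over c)
  row∈R : ∀ c → R (row c)
  row∈R c = proj₁ (proj₂ (over c))
  projects : ∀ c → pr idx (row c) ≡ rb a b c
  projects c = proj₂ (proj₂ (over c))
  within : ∀ {x} → R x → x ∈₃ lookup (t₁ ∷ t₂ ∷ t₃ ∷ [])
  within = Equivalence.to (listed _)

isRBExt : {R : Rel D n} → RBForm R → IsRBExt R
isRBExt {D = D} {n} {R} F =
  (row zero , row (suc zero) , row (suc (suc zero)) , enumerates row-injective members) ,
  (a , b , a≢b , idx , λ w → mk⇔ hit reached)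
  where
  open RBForm F
  hit : ∀ {w} → (Σ (Vec D n) λ t → R t × pr idx t ≡ w) → w ∈₃ rb a b
  hit (t , Rt , e) with Equivalence.to (members t) Rt
  ... | c , refl = Equivalence.from (∈₃⇔ {f = rb a b}) (c , trans (sym e) (projects c))
  reached : ∀ {w} → w ∈₃ rb a b → Σ (Vec D n) λ t → R t × pr idx t ≡ w
  reached w∈ with Equivalence.to (∈₃⇔ {f = rb a b}) w∈
  ... | c , refl = row c , Equivalence.from (members (row c)) (c , refl) , projects c

saturated : {R : Rel D n} (F : RBForm R) → ColumnClosed (RBForm.row F) → IsSaturatedRBExt R
saturated F closed =
  isRBExt F , row zero , row (suc zero) , row (suc (suc zero)) ,
  enumerates row-injective members , closed-column {f = row} closed
  where open RBForm F

Image : (Fin 3 → Vec D n) → Rel D n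
Image f x = ∃ λ c → x ≡ f c

-- Self-maps of Fin 3 are coded by Fin 27 = Fin (3 ^ 3).  The coding and the
-- spread below are opaque: they are used only through their equations,
-- which keeps type checking from unfolding them.
opaque
  code : (Fin 3 → Fin 3) → Fin 27
  code = funToFin

  decode : Fin 27 → Fin 3 → Fin 3
  decode = finToFun

  decode-code : ∀ τ s → decode (code τ) s ≡ τ s
  decode-code = finToFun-funToFin

  spread : (Fin 3 → Vec D n) → Fin 3 → Vec D (27 * n)
  spread {n = n} u c = tabulate λ p → lookup (u (decode (proj₁ (remQuot {27} n p)) c)) (proj₂ (remQuot {27} n p))

  lookup-spread : (u : Fin 3 → Vec D n) → ∀ c σ i → lookup (spread u c) (combine σ i) ≡ lookup (u (decode σ c)) i
  lookup-spread {n = n} u c σ i =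
    trans (lookup∘tabulate _ (combine σ i))
          (cong (λ q → lookup (u (decode (proj₁ q) c)) (proj₂ q)) (remQuot-combine {27} {n} σ i))

ι : Fin 27
ι = code id

decode-ι : ∀ c → decode ι c ≡ c
decode-ι = decode-code id

spread-identity : (u : Fin 3 → Vec D n) → ∀ c i → lookup (spread u c) (combine ι i) ≡ lookup (u c) i
spread-identity u c i = trans (lookup-spread u c ι i) (cong (λ d → lookup (u d) i) (decode-ι c))

block : Fin 27 → Vec D (27 * n) → Vec D n
block σ x = tabulate (lookup x ∘ combine σ)

lookup-block : ∀ σ (x : Vec D (27 * n)) i → lookup (block {n = n} σ x) i ≡ lookup x (combine σ i)
lookup-block σ x = lookup∘tabulate (lookup x ∘ combine σ)

block-spread : (u : Fin 3 → Vec D n) → ∀ σ c → block σ (spread u c) ≡ u (decode σ c)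
block-spread u σ c = trans (tabulate-cong (lookup-spread u c σ)) (tabulate∘lookup (u (decode σ c)))

-- Re-indexing along τ maps block σ onto block σ ∘ τ, so any spread is
-- column closed.
spread-closed : (u : Fin 3 → Vec D n) → ColumnClosed (spread u)
spread-closed u = combine-ind λ σ i τ → combine (code (decode σ ∘ τ)) i , λ s → begin
    lookup (spread u (τ s)) (combine σ i)             ≡⟨ lookup-spread u (τ s) σ i ⟩
    lookup (u (decode σ (τ s))) i                     ≡⟨ cong (λ c → lookup (u c) i) (decode-code (decode σ ∘ τ) s) ⟨
    lookup (u (decode (code (decode σ ∘ τ)) s)) i     ≡⟨ lookup-spread u s (code (decode σ ∘ τ)) i ⟨
    lookup (spread u s) (combine (code (decode σ ∘ τ)) i) ∎
  where open ≡-Reasoning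

-- The identity block of a spread reproduces the original rows, so the spread
-- of a presentation is again a presentation (projecting onto that block).
spread-form : {R : Rel D n} (F : RBForm R) → RBForm (Image (spread (RBForm.row F)))
spread-form F = record
  { a = a ; b = b ; a≢b = a≢b ; idx = map (combine ι) idx ; row = spread row
  ; members = λ _ → ⇔.refl
  ; projects = λ c → begin
      pr (map (combine ι) idx) (spread row c)     ≡⟨ map-∘ _ _ idx ⟨
      map (lookup (spread row c) ∘ combine ι) idx ≡⟨ map-cong (spread-identity row c) idx ⟩
      pr idx (row c)                              ≡⟨ projects c ⟩
      rb a b c                                    ∎
  }
  where
  open RBForm F
  open ≡-Reasoning

-- The formula
-- asks every block to lie in R and ties entry idx j of block σ to entry
-- idx (shift σ j) of the identity block, where column shift σ j of R_𝔹 is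
-- column j re-indexed along σ.
module Definability {R : Rel D n} (F : RBForm R) where
  open RBForm F
  open ≡-Reasoning

  shift : Fin 27 → Fin 8 → Fin 8
  shift σ j = proj₁ (rb-closed {a = a} {b} j (decode σ))

  shift-correct : ∀ σ j c → lookup (rb a b (decode σ c)) j ≡ lookup (rb a b c) (shift σ j)
  shift-correct σ j = proj₂ (rb-closed {a = a} {b} j (decode σ))

  blockAtom : Fin 27 → Atom n (27 * n)
  blockAtom σ = rel (tabulate (combine σ))

  linkAtom : Fin 27 → Fin 8 → Atom n (27 * n)
  linkAtom σ j = eq (combine σ (lookup idx j)) (combine ι (lookup idx (shift σ j)))

  formula : List (Atom n (27 * n))
  formula = List.tabulate blockAtom ++ table linkAtom

  Satisfies : Vec D (27 * n) → Set
  Satisfies x =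
    (∀ σ → R (block σ x)) ×
    (∀ σ j → lookup x (combine σ (lookup idx j)) ≡ lookup x (combine ι (lookup idx (shift σ j))))

  formula⇔ : ∀ x → All (λ α → ⟦ α ⟧ₐ R x) formula ⇔ Satisfies x
  formula⇔ x = mk⇔ to from
    where
    P : Atom n (27 * n) → Set
    P α = ⟦ α ⟧ₐ R x
    blockAtom⇔ : ∀ σ → P (blockAtom σ) ≡ R (block σ x)
    blockAtom⇔ σ = cong R (sym (tabulate-∘ (lookup x) (combine σ)))
    to : All P formula → Satisfies x
    to all with ++⁻ {P = P} (List.tabulate blockAtom) {table linkAtom} all
    ... | blocks , links =
      (λ σ → subst id (blockAtom⇔ σ) (tabulate⁻ {P = P} {f = blockAtom} blocks σ)) ,
      Equivalence.to (All-table {P = P} {f = linkAtom}) links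
    from : Satisfies x → All P formula
    from (blocks , links) = ++⁺ {P = P}
      (tabulate⁺ {P = P} {f = blockAtom} (λ σ → subst id (sym (blockAtom⇔ σ)) (blocks σ)))
      (Equivalence.from (All-table {P = P} {f = linkAtom}) links)

  sound : ∀ c → Satisfies (spread row c)
  sound c = (λ σ → subst R (sym (block-spread row σ c)) (Equivalence.from (members _) (_ , refl))) , link
    where
    link : ∀ σ j → lookup (spread row c) (combine σ (lookup idx j)) ≡
                   lookup (spread row c) (combine ι (lookup idx (shift σ j)))
    link σ j = begin
      lookup (spread row c) (combine σ (lookup idx j))            ≡⟨ lookup-spread row c σ _ ⟩
      lookup (row (decode σ c)) (lookup idx j)                    ≡⟨ row-at _ j ⟩
      lookup (rb a b (decode σ c)) j                              ≡⟨ shift-correct σ j c ⟩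
      lookup (rb a b c) (shift σ j)                               ≡⟨ row-at c _ ⟨
      lookup (row c) (lookup idx (shift σ j))                     ≡⟨ spread-identity row c _ ⟨
      lookup (spread row c) (combine ι (lookup idx (shift σ j)))  ∎

  -- Each block of a satisfying x is some row; the links force block σ to be
  -- row (σ c₀), where block ι is row c₀.  Hence x is the c₀-th spread tuple.
  complete : ∀ {x} → Satisfies x → ∃ λ c → x ≡ spread row c
  complete {x} (blocks , links) =
    c₀ , vext (combine-ind {P = λ p → lookup x p ≡ lookup (spread row c₀) p} entry)
    where
    choice : Fin 27 → Fin 3
    choice σ = proj₁ (Equivalence.to (members _) (blocks σ))
    x-at : ∀ σ i → lookup x (combine σ i) ≡ lookup (row (choice σ)) i
    x-at σ i = trans (sym (lookup-block {n = n} σ x i))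
                     (cong (λ v → lookup v i) (proj₂ (Equivalence.to (members _) (blocks σ))))
    c₀ : Fin 3
    c₀ = choice ι
    choice-correct : ∀ σ → choice σ ≡ decode σ c₀
    choice-correct σ = rb-injective {a = a} {b} a≢b {choice σ} {decode σ c₀} (vext λ j → begin
      lookup (rb a b (choice σ)) j                     ≡⟨ row-at _ j ⟨
      lookup (row (choice σ)) (lookup idx j)           ≡⟨ x-at σ _ ⟨
      lookup x (combine σ (lookup idx j))              ≡⟨ links σ j ⟩
      lookup x (combine ι (lookup idx (shift σ j)))    ≡⟨ x-at ι _ ⟩
      lookup (row c₀) (lookup idx (shift σ j))         ≡⟨ row-at c₀ _ ⟩
      lookup (rb a b c₀) (shift σ j)                   ≡⟨ shift-correct σ j c₀ ⟨
      lookup (rb a b (decode σ c₀)) j                  ∎)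
    entry : ∀ σ i → lookup x (combine σ i) ≡ lookup (spread row c₀) (combine σ i)
    entry σ i = begin
      lookup x (combine σ i)                ≡⟨ x-at σ i ⟩
      lookup (row (choice σ)) i             ≡⟨ cong (λ d → lookup (row d) i) (choice-correct σ) ⟩
      lookup (row (decode σ c₀)) i          ≡⟨ lookup-spread row c₀ σ i ⟨
      lookup (spread row c₀) (combine σ i)  ∎

  definable : QfppDefinable R (Image (spread row))
  definable = formula , λ x → ⇔.trans (mk⇔ (λ { (c , refl) → sound c }) complete) (⇔.sym (formula⇔ x))

lemma3 : ∀ {k n : ℕ} (R : Rel (Fin k) n) → IsRBExt R →
    Σ ℕ λ m → Σ (Rel (Fin k) m) λ R' → IsSaturatedRBExt R' × QfppDefinable R R'
lemma3 {n = n} R isExt =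
  27 * n , Image (spread row) ,
  saturated (spread-form F) (spread-closed row) ,
  Definability.definable F
  where
  F : RBForm R
  F = presentation isExt
  open RBForm F using (row)
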